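{- For every natural number $n$, there is a digraph $D$ with two Grundy functions $f$ and $g$ such that $\max\{f(x): x\in V(D)\}-\max\{g(x): x\in V(D)\}=n$.
   Context: For a vertex $x$ of a digraph $D$, $\Gamma^+(x)$ denotes the set of out-neighbours of $x$. A function $g:V(D)\to\{0,1,2,\dots\}$ is a Grundy function of $D$ if for every vertex $x$, $g(x)$ is the smallest non-negative integer not belonging to $\{g(y): y\in\Gamma^+(x)\}$. -}

module Defs where

open import Data.Nat using (ℕ; _<_; _≤_; _+_)
open import Data.Fin using (Fin)
open import Data.Bool using (Bool; true)
open import Data.Product using (_×_; ∃-syntax)
open import Relation.Binary.PropositionalEquality using (_≡_; _≢_)

-- A finite digraph on vertex set Fin m, given by its arc relation
-- (adj x y ≡ true  iff  (x , y) is an arc, i.e. y ∈ Γ⁺(x)).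
record Digraph : Set where
  field
    m   : ℕ
    adj : Fin m → Fin m → Bool

open Digraph public

Vertex : Digraph → Set
Vertex D = Fin (m D)

OutNbr : (D : Digraph) → Vertex D → Vertex D → Set
OutNbr D x y = adj D x y ≡ true

-- g(x) is the minimum non-negative integer not in {g(y) : y ∈ Γ⁺(x)}:
-- (i) no out-neighbour has value g(x), and
-- (ii) every k < g(x) is the value of some out-neighbour.
IsGrundy : (D : Digraph) → (Vertex D → ℕ) → Set
IsGrundy D g = (x : Vertex D) →
    ((y : Vertex D) → OutNbr D x y → g y ≢ g x)
  × ((k : ℕ) → k < g x → ∃[ y ] (OutNbr D x y × g y ≡ k))

IsMax : (D : Digraph) → (Vertex D → ℕ) → ℕ → Set
IsMax D f M = (∃[ x ] f x ≡ M) × ((x : Vertex D) → f x ≤ M)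

module Submission where

-- Let the crown S_k be the symmetric digraph with vertices (s , i),
-- s ∈ {0,1} a side and i < k an index, and an arc (s , i) → (s' , j)
-- exactly when s ≠ s' and i ≠ j (the complete bipartite graph K_{k,k}
-- minus a perfect matching).  It carries two Grundy functions:
--   * the index function (s , i) ↦ i, with maximum k - 1 (any k ≥ 1);
--   * the side function (s , i) ↦ s, with maximum 1 (any k ≥ 2).
-- Taking k = n + 2 the maxima differ by exactly n.

open import Defs
open import Data.Nat using (ℕ; zero; suc; _+_; _<_; _≤_; _*_; s≤s)
open import Data.Nat.Properties using (<-trans; <⇒≢)
open import Data.Bool using (Bool; true; not; _∧_)
open import Data.Fin using (Fin; toℕ; fromℕ; fromℕ<; combine; remQuot)
  renaming (zero to fzero; suc to fsuc)
open import Data.Fin.Properties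
  using (_≟_; toℕ-injective; toℕ-fromℕ; toℕ-fromℕ<; toℕ<n; toℕ≤pred[n]; remQuot-combine)
open import Data.Empty using (⊥-elim)
open import Data.Product using (_×_; _,_; ∃-syntax; proj₁; proj₂; uncurry)
open import Function using (_∘_)
open import Relation.Nullary using (yes; no; does)
open import Relation.Binary.PropositionalEquality using (_≡_; _≢_; refl; cong; sym; trans)

IsGrundyOn : {V : Set} → (V → V → Bool) → (V → ℕ) → Set
IsGrundyOn {V} arc g = (x : V) →
    ((y : V) → arc x y ≡ true → g y ≢ g x)
  × ((k : ℕ) → k < g x → ∃[ y ] (arc x y ≡ true × g y ≡ k))

IsMaxOn : {V : Set} → (V → ℕ) → ℕ → Set
IsMaxOn {V} g M = (∃[ v ] g v ≡ M) × ((v : V) → g v ≤ M)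

record Encoding (V : Set) (m : ℕ) : Set where
  field
    decode    : Fin m → V
    encode    : V → Fin m
    decode∘encode : (v : V) → decode (encode v) ≡ v

open Encoding

present : {V : Set} {m : ℕ} → Encoding V m → (V → V → Bool) → Digraph
present {m = m} E arc = record { m = m ; adj = λ x y → arc (decode E x) (decode E y) }

-- Grundy functions transfer to the presented digraph: out-neighbours of a
-- code are the codes of out-neighbours, and every vertex has a code.
present-grundy : {V : Set} {m : ℕ} (E : Encoding V m) (arc : V → V → Bool)
  (g : V → ℕ) → IsGrundyOn arc g → IsGrundy (present E arc) (g ∘ decode E)
present-grundy E arc g grundy x = avoids , attains
  where
  avoids : (y : Fin _) → arc (decode E x) (decode E y) ≡ true → g (decode E y) ≢ g (decode E x)
  avoids y = proj₁ (grundy (decode E x)) (decode E y)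

  attains : (k : ℕ) → k < g (decode E x) →
            ∃[ y ] (arc (decode E x) (decode E y) ≡ true × g (decode E y) ≡ k)
  attains k k<gx with proj₂ (grundy (decode E x)) k k<gx
  ... | v , arc-xv , gv≡k rewrite sym (decode∘encode E v) =
    encode E v , arc-xv , gv≡k

present-max : {V : Set} {m : ℕ} (E : Encoding V m) (arc : V → V → Bool)
  (g : V → ℕ) (M : ℕ) → IsMaxOn g M → IsMax (present E arc) (g ∘ decode E) M
present-max E arc g M ((v , gv≡M) , bound) =
  (encode E v , trans (cong g (decode∘encode E v)) gv≡M) , bound ∘ decode E

Side : Set
Side = Fin 2

CrownVertex : ℕ → Set
CrownVertex k = Side × Fin k

crown : (k : ℕ) → CrownVertex k → CrownVertex k → Bool
crown k (s , i) (s' , j) = not (does (s ≟ s')) ∧ not (does (i ≟ j))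

crownEncoding : (k : ℕ) → Encoding (CrownVertex k) (2 * k)
crownEncoding k = record
  { decode = remQuot k
  ; encode = uncurry combine
  ; decode∘encode = λ (s , i) → remQuot-combine s i
  }

arc⇒distinct : {k : ℕ} (s s' : Side) (i j : Fin k) →
  crown k (s , i) (s' , j) ≡ true → s ≢ s' × i ≢ j
arc⇒distinct s s' i j arc with s ≟ s' | i ≟ j
... | no s≢s' | no i≢j = s≢s' , i≢j

distinct⇒arc : {k : ℕ} (s s' : Side) (i j : Fin k) →
  s ≢ s' → i ≢ j → crown k (s , i) (s' , j) ≡ true
distinct⇒arc s s' i j s≢s' i≢j with s ≟ s' | i ≟ j
... | yes s≡s' | _        = ⊥-elim (s≢s' s≡s')
... | no _     | yes i≡j  = ⊥-elim (i≢j i≡j)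
... | no _     | no _     = refl

opposite : Side → Side
opposite fzero = fsuc fzero
opposite (fsuc _) = fzero

opposite-≢ : (s : Side) → s ≢ opposite s
opposite-≢ fzero ()
opposite-≢ (fsuc fzero) ()

-- The index function is a Grundy function of every crown: below index i,
-- each value t is the index of the vertex (opposite side, t).
index : {k : ℕ} → CrownVertex k → ℕ
index (_ , i) = toℕ i

index-grundy : (k : ℕ) → IsGrundyOn (crown k) index
index-grundy k (s , i) = avoids , attains
  where
  avoids : (y : CrownVertex k) → crown k (s , i) y ≡ true → index y ≢ toℕ i
  avoids (s' , j) arc j≡i with arc⇒distinct s s' i j arc
  ... | _ , i≢j = i≢j (toℕ-injective (sym j≡i))

  attains : (t : ℕ) → t < toℕ i → ∃[ y ] (crown k (s , i) y ≡ true × index y ≡ t)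
  attains t t<i = (opposite s , j) , distinct⇒arc s (opposite s) i j (opposite-≢ s) i≢j , toℕ-fromℕ< t<k
    where
    t<k : t < k
    t<k = <-trans t<i (toℕ<n i)
    j : Fin k
    j = fromℕ< t<k
    i≢j : i ≢ j
    i≢j i≡j = <⇒≢ t<i (trans (sym (toℕ-fromℕ< t<k)) (cong toℕ (sym i≡j)))

-- The side function is a Grundy function as soon as every index has a
-- different index: side-1 vertices need a side-0 out-neighbour.
side : {k : ℕ} → CrownVertex k → ℕ
side (s , _) = toℕ s

side-grundy : (k : ℕ) → ((i : Fin k) → ∃[ j ] i ≢ j) → IsGrundyOn (crown k) side
side-grundy k another (s , i) = avoids , attains s
  where
  avoids : (y : CrownVertex k) → crown k (s , i) y ≡ true → side y ≢ toℕ s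
  avoids (s' , j) arc s'≡s with arc⇒distinct s s' i j arc
  ... | s≢s' , _ = s≢s' (toℕ-injective (sym s'≡s))

  attains : (s : Side) (t : ℕ) → t < toℕ s → ∃[ y ] (crown k (s , i) y ≡ true × side y ≡ t)
  attains (fsuc fzero) zero _ with another i
  ... | j , i≢j = (fzero , j) , distinct⇒arc (fsuc fzero) fzero i j (λ ()) i≢j , refl
  attains (fsuc fzero) (suc t) (s≤s ())

another-index : (n : ℕ) (i : Fin (suc (suc n))) → ∃[ j ] i ≢ j
another-index n fzero    = fsuc fzero , λ ()
another-index n (fsuc i) = fzero , λ ()

index-max : (n : ℕ) → IsMaxOn (index {suc n}) n
index-max n = ((fzero , fromℕ n) , toℕ-fromℕ n) , λ (_ , i) → toℕ≤pred[n] i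

side-max : (n : ℕ) → IsMaxOn (side {suc n}) 1
side-max n = ((fsuc fzero , fzero) , refl) , λ (s , _) → toℕ≤pred[n] s

theorem8 : (n : ℕ) → ∃[ D ] ∃[ f ] ∃[ g ] ∃[ Mf ] ∃[ Mg ]
    (IsGrundy D f × IsGrundy D g × IsMax D f Mf × IsMax D g Mg × Mf ≡ Mg + n)
theorem8 n =
  present E arc , index ∘ decode E , side ∘ decode E , suc n , 1
  , present-grundy E arc index (index-grundy k)
  , present-grundy E arc side (side-grundy k (another-index n))
  , present-max E arc index (suc n) (index-max (suc n))
  , present-max E arc side 1 (side-max (suc n))
  , refl
  where
  k : ℕ
  k = suc (suc n)
  E : Encoding (CrownVertex k) (2 * k)
  E = crownEncoding k
  arc : CrownVertex k → CrownVertex k → Bool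
  arc = crown k
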